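{- Let $p$ be a prime and $f\ge1$. Let $r_0,\dots,r_{f-1}$ be integers in $[1,p]$, let $J\subset\{0,\dots,f-1\}$, and set $h_i=r_i$ if $i\in J$ and $h_i=0$ if $i\notin J$. Then \[\sum_{i=0}^{f-1}p^{f-1-i}h_i\equiv\sum_{i=0}^{f-1}p^{f-1-i}(r_i-h_i)\pmod{p^f-1}\] if and only if either $(r_0,\dots,r_{f-1})\in\mathcal{P}$ and $J$ satisfies: if $(r_{i-1},r_i)=(p,1)$ then $i+1\in J\iff i\notin J$, and if $(r_{i-1},r_i)=(1,p-1)$ or $(p-1,p-1)$ then $i+1\in J\iff i\in J$; or else $p=2$, $(r_0,\dots,r_{f-1})=(2,\dots,2)$, and $J=\varnothing$ or $J=\{0,1,\dots,f-1\}$.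
   Context: Indices are taken modulo $f$. $\mathcal{P}$ is the set of $f$-tuples $(r_0,\dots,r_{f-1})$ with $r_i\in\{1,p-1,p\}$ for all $i$ such that: if $r_i=p$ then $r_{i+1}=1$, and if $r_i\in\{1,p-1\}$ then $r_{i+1}\in\{p-1,p\}$ (conventionally $r_f=r_0$). -}

module Defs where

open import Data.Nat using (ℕ; zero; suc; _+_; _*_; _∸_; _^_; _≤_)
open import Data.Nat.DivMod using (_mod_)
open import Data.Fin using (Fin; toℕ)
open import Data.Fin.Subset using (Subset; _∈_; _∉_)
open import Data.Vec using (lookup)
open import Data.Bool using (if_then_else_)
open import Data.List using (map; allFin)
open import Data.Nat.ListAction using (sum)
open import Data.Integer as ℤ using (ℤ; +_)
open import Data.Integer.Divisibility using () renaming (_∣_ to _∣ℤ_)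
open import Data.Product using (_×_)
open import Data.Sum using (_⊎_)
open import Relation.Binary.PropositionalEquality using (_≡_)
open import Function.Bundles using (_⇔_)

sucMod : ∀ {k} → Fin (suc k) → Fin (suc k)
sucMod {k} i = (suc (toℕ i)) mod (suc k)

predMod : ∀ {k} → Fin (suc k) → Fin (suc k)
predMod {k} i = (toℕ i + k) mod (suc k)

_≡_[mod_] : ℕ → ℕ → ℕ → Set
a ≡ b [mod m ] = (+ m) ∣ℤ ((+ a) ℤ.- (+ b))

ΣFin : (f : ℕ) → (Fin f → ℕ) → ℕ
ΣFin f g = sum (map g (allFin f))

hvec : ∀ {f} → (Fin f → ℕ) → Subset f → Fin f → ℕ
hvec r J i = if lookup J i then r i else 0

InP : ∀ {k} → ℕ → (Fin (suc k) → ℕ) → Set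
InP p r = ∀ i →
  (r i ≡ 1 ⊎ r i ≡ p ∸ 1 ⊎ r i ≡ p)
  × (r i ≡ p → r (sucMod i) ≡ 1)
  × ((r i ≡ 1 ⊎ r i ≡ p ∸ 1) → (r (sucMod i) ≡ p ∸ 1 ⊎ r (sucMod i) ≡ p))

JCond : ∀ {k} → ℕ → (Fin (suc k) → ℕ) → Subset (suc k) → Set
JCond p r J = ∀ i →
  ((r (predMod i) ≡ p × r i ≡ 1) → (sucMod i ∈ J ⇔ i ∉ J))
  × (((r (predMod i) ≡ 1 × r i ≡ p ∸ 1) ⊎ (r (predMod i) ≡ p ∸ 1 × r i ≡ p ∸ 1))
       → (sucMod i ∈ J ⇔ i ∈ J))

{-# OPTIONS --safe #-}

-- Write d i = ± r i, with sign + exactly when i ∈ J; the difference of the two sums is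
-- Σ p^(f-1-i) d i.  Telescoping shows that p^f − 1 divides it iff there are cyclic carries c
-- with d i + c (i+1) = p · c i for all i.  At an index where |c| is largest,
-- p |c| ≤ r + |c| ≤ p + |c|, so |c| ≤ 1 everywhere unless p = 2 and that maximum is 2; such a
-- carry ±2 propagates around the cycle and forces r ≡ 2 and J = ∅ or J = {0,…,f-1}.
-- For carries in {-1, 0, 1} the equation at a single index has only three kinds of solutions
-- (Transition): digit 1 after carry 0, digit p followed by carry 0, and digit p − 1 passing
-- its carry on, the non-zero carries being the sign of the digit.  Chaining them around the
-- cycle gives exactly 𝒫 together with the condition on J; conversely, the carry that is 0 right
-- after a digit p and the sign of the digit elsewhere solves all the equations.
module Submission where

open import Defs
open import Data.Nat using (ℕ; suc; _*_; _∸_; _^_; _≤_)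
open import Data.Nat.Primality using (Prime)
open import Data.Fin using (Fin; toℕ)
open import Data.Fin.Subset using (Subset; ⊥; ⊤)
open import Data.Product using (_×_)
open import Data.Sum using (_⊎_)
open import Relation.Binary.PropositionalEquality using (_≡_)
open import Function.Bundles using (_⇔_)

open import Data.Bool using (Bool; true; false; not)
open import Data.Bool.Properties using (not-involutive)
open import Data.Empty using (⊥-elim)
open import Data.Fin as F using ()
import Data.Fin.Properties as FP
open import Data.Fin.Subset using (_∈_; _∉_)
open import Data.Integer as ℤ using (ℤ; +_; -[1+_])
import Data.Integer.Properties as ℤP
open import Data.Integer.Divisibility using () renaming (_∣_ to _∣ℤ_)
import Data.Integer.Divisibility.Signed as Signed
open import Data.Integer.Tactic.RingSolver using (solve-∀)
open import Data.List using (allFin)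
open import Data.List.Membership.Propositional.Properties using (∈-allFin)
open import Data.List.Properties using (map-tabulate; map-cong)
import Data.List.Relation.Unary.All as All
open import Data.Nat as ℕ using (zero; _+_; _<_; _%_; s≤s; z≤n; NonZero)
import Data.Nat.Properties as ℕP
open import Data.List.Extrema ℕP.≤-totalOrder using (argmax; f[xs]≤f[argmax])
open import Data.Nat.DivMod using (_mod_; m%n<n; m<n⇒m%n≡m; %-distribˡ-+; m%n%n≡m%n; [m+n]%n≡m%n)
open import Data.Nat.ListAction using (sum)
open import Data.Nat.Primality using (prime⇒nonTrivial; prime⇒nonZero)
open import Data.Nat.Tactic.RingSolver using () renaming (solve-∀ to solve-∀ℕ)
open import Data.Product using (∃; _,_; proj₁; proj₂)
open import Data.Sum as Sum using (inj₁; inj₂)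
open import Data.Vec using (Vec; []; _∷_; lookup; replicate)
open import Data.Vec.Properties using ([]=⇒lookup; lookup⇒[]=; lookup-replicate)
open import Function using (_∘_)
open import Function.Bundles using (mk⇔; Equivalence)
open import Relation.Binary.PropositionalEquality
  using (_≢_; refl; sym; trans; cong; cong₂; subst; subst₂; module ≡-Reasoning)
open import Relation.Nullary using (¬_; Dec; yes; no)

private variable
  p r : ℕ
  b : Bool
  x y : ℤ

-- Horner sums

ΣFin-suc : ∀ n (g : Fin (suc n) → ℕ) → ΣFin (suc n) g ≡ g F.zero + ΣFin n (g ∘ F.suc)
ΣFin-suc n g = cong (λ xs → g F.zero + sum xs)
  (trans (map-tabulate F.suc g) (sym (map-tabulate (λ i → i) (g ∘ F.suc))))

ΣFin-cong : ∀ n {g h : Fin n → ℕ} → (∀ i → g i ≡ h i) → ΣFin n g ≡ ΣFin n h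
ΣFin-cong n eq = cong sum (map-cong eq (allFin n))

+-isolate : ∀ {a b e} → a ℤ.+ b ≡ e → a ≡ e ℤ.- b
+-isolate {a} {b} eq = trans (addSub a b) (cong (ℤ._- b) eq)
  where
    addSub : ∀ a b → a ≡ a ℤ.+ b ℤ.- b
    addSub = solve-∀

module _ (p : ℕ) where

  horner : ℕ → (ℕ → ℤ) → ℤ
  horner zero    g = g 0
  horner (suc k) g = + (p ^ suc k) ℤ.* g 0 ℤ.+ horner k (g ∘ suc)

  ΣFin-toℕ≡horner : ∀ k (g : ℕ → ℕ) →
                + ΣFin (suc k) (λ i → p ^ (k ∸ toℕ i) * g (toℕ i)) ≡ horner k (λ n → + g n)
  ΣFin-toℕ≡horner zero    g = cong +_ (trans (ℕP.+-identityʳ _) (ℕP.+-identityʳ (g 0)))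
  ΣFin-toℕ≡horner (suc k) g = begin
      + ΣFin (suc (suc k)) (λ i → p ^ (suc k ∸ toℕ i) * g (toℕ i))
    ≡⟨ cong +_ (ΣFin-suc (suc k) (λ i → p ^ (suc k ∸ toℕ i) * g (toℕ i))) ⟩
      + (p ^ suc k * g 0 + ΣFin (suc k) (λ i → p ^ (k ∸ toℕ i) * g (suc (toℕ i))))
    ≡⟨ ℤP.pos-+ (p ^ suc k * g 0) _ ⟩
      + (p ^ suc k * g 0) ℤ.+ + ΣFin (suc k) (λ i → p ^ (k ∸ toℕ i) * g (suc (toℕ i)))
    ≡⟨ cong₂ ℤ._+_ (ℤP.pos-* (p ^ suc k) (g 0)) (ΣFin-toℕ≡horner k (g ∘ suc)) ⟩
      horner (suc k) (λ n → + g n) ∎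
    where open ≡-Reasoning

  horner-snoc : ∀ k g → horner (suc k) g ≡ + p ℤ.* horner k g ℤ.+ g (suc k)
  horner-snoc zero    g = cong (λ z → + z ℤ.* g 0 ℤ.+ g 1) (ℕP.*-identityʳ p)
  horner-snoc (suc k) g = begin
      + (p ^ suc (suc k)) ℤ.* g 0 ℤ.+ horner (suc k) (g ∘ suc)
    ≡⟨ cong₂ (λ a b → a ℤ.* g 0 ℤ.+ b) (ℤP.pos-* p (p ^ suc k)) (horner-snoc k (g ∘ suc)) ⟩
      + p ℤ.* + (p ^ suc k) ℤ.* g 0 ℤ.+ (+ p ℤ.* horner k (g ∘ suc) ℤ.+ g (suc (suc k)))
    ≡⟨ regroup (+ p) (+ (p ^ suc k)) (g 0) (horner k (g ∘ suc)) (g (suc (suc k))) ⟩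
      + p ℤ.* horner (suc k) g ℤ.+ g (suc (suc k)) ∎
    where
      open ≡-Reasoning
      regroup : ∀ P Q a t b → P ℤ.* Q ℤ.* a ℤ.+ (P ℤ.* t ℤ.+ b) ≡ P ℤ.* (Q ℤ.* a ℤ.+ t) ℤ.+ b
      regroup = solve-∀

  horner-telescope : (d c : ℕ → ℤ) → (∀ n → d n ℤ.+ c (suc n) ≡ + p ℤ.* c n) →
                     ∀ k → horner k d ≡ + (p ^ suc k) ℤ.* c 0 ℤ.- c (suc k)
  horner-telescope d c step zero = begin
      d 0                           ≡⟨ +-isolate (step 0) ⟩
      + p ℤ.* c 0 ℤ.- c 1           ≡⟨ cong (λ z → + z ℤ.* c 0 ℤ.- c 1) (sym (ℕP.*-identityʳ p)) ⟩
      + (p ^ 1) ℤ.* c 0 ℤ.- c 1     ∎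
    where open ≡-Reasoning
  horner-telescope d c step (suc k) = begin
      horner (suc k) d
    ≡⟨ horner-snoc k d ⟩
      + p ℤ.* horner k d ℤ.+ d (suc k)
    ≡⟨ cong₂ (λ a b → + p ℤ.* a ℤ.+ b) (horner-telescope d c step k) (+-isolate (step (suc k))) ⟩
      + p ℤ.* (+ (p ^ suc k) ℤ.* c 0 ℤ.- c (suc k)) ℤ.+ (+ p ℤ.* c (suc k) ℤ.- c (suc (suc k)))
    ≡⟨ cancel (+ p) (+ (p ^ suc k)) (c 0) (c (suc k)) (c (suc (suc k))) ⟩
      + p ℤ.* + (p ^ suc k) ℤ.* c 0 ℤ.- c (suc (suc k))
    ≡⟨ cong (λ z → z ℤ.* c 0 ℤ.- c (suc (suc k))) (sym (ℤP.pos-* p (p ^ suc k))) ⟩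
      + (p ^ suc (suc k)) ℤ.* c 0 ℤ.- c (suc (suc k)) ∎
    where
      open ≡-Reasoning
      cancel : ∀ P Q a b e → P ℤ.* (Q ℤ.* a ℤ.- b) ℤ.+ (P ℤ.* b ℤ.- e) ≡ P ℤ.* Q ℤ.* a ℤ.- e
      cancel = solve-∀

  horner-cong : ∀ k {g h : ℕ → ℤ} → (∀ n → g n ≡ h n) → horner k g ≡ horner k h
  horner-cong zero    eq = eq 0
  horner-cong (suc k) eq = cong₂ (λ a b → + (p ^ suc k) ℤ.* a ℤ.+ b) (eq 0) (horner-cong k (eq ∘ suc))

  horner-sub : ∀ k (g h : ℕ → ℤ) → horner k g ℤ.- horner k h ≡ horner k (λ n → g n ℤ.- h n)
  horner-sub zero    g h = refl
  horner-sub (suc k) g h = trans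
    (distrib (+ (p ^ suc k)) (g 0) (h 0) (horner k (g ∘ suc)) (horner k (h ∘ suc)))
    (cong (ℤ._+_ (+ (p ^ suc k) ℤ.* (g 0 ℤ.- h 0))) (horner-sub k (g ∘ suc) (h ∘ suc)))
    where
      distrib : ∀ P a b x y → (P ℤ.* a ℤ.+ x) ℤ.- (P ℤ.* b ℤ.+ y) ≡ P ℤ.* (a ℤ.- b) ℤ.+ (x ℤ.- y)
      distrib = solve-∀

module _ {k : ℕ} where

  toℕ-mod : ∀ m → toℕ (m mod suc k) ≡ m % suc k
  toℕ-mod m = FP.toℕ-fromℕ< (m%n<n m (suc k))

  mod-cong : ∀ m n → m % suc k ≡ n % suc k → m mod suc k ≡ n mod suc k
  mod-cong m n eq = FP.toℕ-injective (trans (toℕ-mod m) (trans eq (sym (toℕ-mod n))))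

  mod-toℕ : (i : Fin (suc k)) → toℕ i mod suc k ≡ i
  mod-toℕ i = FP.toℕ-injective (trans (toℕ-mod (toℕ i)) (m<n⇒m%n≡m (FP.toℕ<n i)))

  mod-+ : ∀ m n → (toℕ (m mod suc k) + n) mod suc k ≡ (m + n) mod suc k
  mod-+ m n = mod-cong (toℕ (m mod suc k) + n) (m + n) (begin
      (toℕ (m mod suc k) + n) % suc k
    ≡⟨ cong (λ x → (x + n) % suc k) (toℕ-mod m) ⟩
      (m % suc k + n) % suc k
    ≡⟨ %-distribˡ-+ (m % suc k) n (suc k) ⟩
      (m % suc k % suc k + n % suc k) % suc k
    ≡⟨ cong (λ x → (x + n % suc k) % suc k) (m%n%n≡m%n m (suc k)) ⟩
      (m % suc k + n % suc k) % suc k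
    ≡⟨ sym (%-distribˡ-+ m n (suc k)) ⟩
      (m + n) % suc k ∎)
    where open ≡-Reasoning

  sucMod-mod : ∀ m → sucMod (m mod suc k) ≡ suc m mod suc k
  sucMod-mod m = begin
      suc (toℕ (m mod suc k)) mod suc k   ≡⟨ cong (_mod suc k) (ℕP.+-comm 1 _) ⟩
      (toℕ (m mod suc k) + 1) mod suc k   ≡⟨ mod-+ m 1 ⟩
      (m + 1) mod suc k                   ≡⟨ cong (_mod suc k) (ℕP.+-comm m 1) ⟩
      suc m mod suc k                     ∎
    where open ≡-Reasoning

  suc-+-mod : (i : Fin (suc k)) → suc (toℕ i + k) mod suc k ≡ i
  suc-+-mod i = trans (mod-cong (suc (toℕ i + k)) (toℕ i) wrap) (mod-toℕ i)
    where
      wrap : suc (toℕ i + k) % suc k ≡ toℕ i % suc k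
      wrap = trans (cong (_% suc k) (sym (ℕP.+-suc (toℕ i) k))) ([m+n]%n≡m%n (toℕ i) (suc k))

  sucMod-predMod : (i : Fin (suc k)) → sucMod (predMod i) ≡ i
  sucMod-predMod i = trans (sucMod-mod (toℕ i + k)) (suc-+-mod i)

  predMod-sucMod : (i : Fin (suc k)) → predMod (sucMod i) ≡ i
  predMod-sucMod i = trans (mod-+ (suc (toℕ i)) k) (suc-+-mod i)

  sucMod-< : (i : Fin (suc k)) → toℕ i < k → toℕ (sucMod i) ≡ suc (toℕ i)
  sucMod-< i i<k = trans (toℕ-mod (suc (toℕ i))) (m<n⇒m%n≡m (s≤s i<k))

  sucMod-last : (i : Fin (suc k)) → toℕ i ≡ k → sucMod i ≡ F.zero
  sucMod-last i i≡k =
    mod-cong (suc (toℕ i)) 0 (trans (cong (λ x → suc x % suc k) i≡k) ([m+n]%n≡m%n 0 (suc k)))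

  sucMod-induction : (Q : Fin (suc k) → Set) → (∀ i → Q i → Q (sucMod i)) → ∀ i → Q i → ∀ j → Q j
  sucMod-induction Q step i Qi j = subst Q (trans (mod-cong (n + toℕ i) (toℕ j) wrap) (mod-toℕ j)) (iterate n)
    where
      n = toℕ j + (suc k ∸ toℕ i)
      iterate : ∀ n → Q ((n + toℕ i) mod suc k)
      iterate zero    = subst Q (sym (mod-toℕ i)) Qi
      iterate (suc n) = subst Q (sucMod-mod (n + toℕ i)) (step _ (iterate n))
      wrap : (n + toℕ i) % suc k ≡ toℕ j % suc k
      wrap = trans (cong (_% suc k) (trans (ℕP.+-assoc (toℕ j) _ (toℕ i))
                      (cong (_+_ (toℕ j)) (ℕP.m∸n+n≡m (ℕP.<⇒≤ (FP.toℕ<n i))))))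
                   ([m+n]%n≡m%n (toℕ j) (suc k))

-- Divisibility by p^f − 1 and cyclic carries

IsCarry : (p : ℕ) {k : ℕ} → (Fin (suc k) → ℤ) → (Fin (suc k) → ℤ) → Set
IsCarry p d c = ∀ i → d i ℤ.+ c (sucMod i) ≡ + p ℤ.* c i

module _ (p k : ℕ) .{{_ : NonZero p}} (d : Fin (suc k) → ℤ) where

  private
    D : ℕ → ℤ
    D n = d (n mod suc k)

    N≡ : + (p ^ suc k ∸ 1) ≡ + (p ^ suc k) ℤ.- + 1
    N≡ = sym (trans (ℤP.[+m]-[+n]≡m⊖n (p ^ suc k) 1) (ℤP.⊖-≥ (ℕP.m^n>0 p (suc k))))

  carry⇒divides : ∀ {c} → IsCarry p d c → + (p ^ suc k ∸ 1) ∣ℤ horner p k D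
  carry⇒divides {c} carry = Signed.∣⇒∣ᵤ (Signed.divides (c F.zero) (begin
      horner p k D
    ≡⟨ horner-telescope p D C carryℕ k ⟩
      + (p ^ suc k) ℤ.* c F.zero ℤ.- c (suc k mod suc k)
    ≡⟨ cong (λ j → + (p ^ suc k) ℤ.* c F.zero ℤ.- c j) (mod-cong (suc k) 0 ([m+n]%n≡m%n 0 (suc k))) ⟩
      + (p ^ suc k) ℤ.* c F.zero ℤ.- c F.zero
    ≡⟨ factor (+ (p ^ suc k)) (c F.zero) ⟩
      c F.zero ℤ.* (+ (p ^ suc k) ℤ.- + 1)
    ≡⟨ cong (c F.zero ℤ.*_) (sym N≡) ⟩
      c F.zero ℤ.* + (p ^ suc k ∸ 1) ∎))
    where
      open ≡-Reasoning
      C : ℕ → ℤ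
      C n = c (n mod suc k)
      carryℕ : ∀ n → D n ℤ.+ C (suc n) ≡ + p ℤ.* C n
      carryℕ n = trans (cong (λ j → D n ℤ.+ c j) (sym (sucMod-mod n))) (carry (n mod suc k))
      factor : ∀ P a → P ℤ.* a ℤ.- a ≡ a ℤ.* (P ℤ.- + 1)
      factor = solve-∀

  periodic-carry⇒IsCarry : (C : ℕ → ℤ) → (∀ n → D n ℤ.+ C (suc n) ≡ + p ℤ.* C n) → C (suc k) ≡ C 0 →
                   IsCarry p d (C ∘ toℕ)
  periodic-carry⇒IsCarry C carryℕ period i = begin
      d i ℤ.+ C (toℕ (sucMod i))       ≡⟨ cong₂ ℤ._+_ (cong d (sym (mod-toℕ i))) next ⟩
      D (toℕ i) ℤ.+ C (suc (toℕ i))    ≡⟨ carryℕ (toℕ i) ⟩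
      + p ℤ.* C (toℕ i)                ∎
    where
      open ≡-Reasoning
      next : C (toℕ (sucMod i)) ≡ C (suc (toℕ i))
      next with ℕP.m≤n⇒m<n∨m≡n (ℕP.≤-pred (FP.toℕ<n i))
      ... | inj₁ i<k = cong C (sucMod-< i i<k)
      ... | inj₂ i≡k =
        trans (cong (C ∘ toℕ) (sucMod-last i i≡k)) (trans (sym period) (cong (C ∘ suc) (sym i≡k)))

  divides⇒carry : + (p ^ suc k ∸ 1) ∣ℤ horner p k D → ∃ (IsCarry p d)
  divides⇒carry N∣ = C ∘ toℕ , periodic-carry⇒IsCarry C carryℕ period
    where
      N∣ˢ : + (p ^ suc k ∸ 1) Signed.∣ horner p k D
      N∣ˢ = Signed.∣ᵤ⇒∣ N∣
      q = Signed.quotient N∣ˢ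
      C : ℕ → ℤ
      C zero    = q
      C (suc n) = + p ℤ.* C n ℤ.- D n
      carryℕ : ∀ n → D n ℤ.+ C (suc n) ≡ + p ℤ.* C n
      carryℕ n = addSub (D n) (+ p ℤ.* C n)
        where
          addSub : ∀ a b → a ℤ.+ (b ℤ.- a) ≡ b
          addSub = solve-∀
      period : C (suc k) ≡ q
      period = solve-for (+ (p ^ suc k)) q (C (suc k)) (begin
          + (p ^ suc k) ℤ.* q ℤ.- C (suc k)   ≡⟨ sym (horner-telescope p D C carryℕ k) ⟩
          horner p k D                         ≡⟨ Signed._∣_.equality N∣ˢ ⟩
          q ℤ.* + (p ^ suc k ∸ 1)              ≡⟨ cong (q ℤ.*_) N≡ ⟩
          q ℤ.* (+ (p ^ suc k) ℤ.- + 1)        ∎)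
        where
          open ≡-Reasoning
          solve-for : ∀ P q x → P ℤ.* q ℤ.- x ≡ q ℤ.* (P ℤ.- + 1) → x ≡ q
          solve-for P q x eq = trans (sym (sub-sub P q x)) (trans (cong (ℤ._-_ (P ℤ.* q)) eq) (sub-mul P q))
            where
              sub-sub : ∀ P q x → P ℤ.* q ℤ.- (P ℤ.* q ℤ.- x) ≡ x
              sub-sub = solve-∀
              sub-mul : ∀ P q → P ℤ.* q ℤ.- q ℤ.* (P ℤ.- + 1) ≡ q
              sub-mul = solve-∀

-- Signed digits and carry transitions

signed : Bool → ℕ → ℤ
signed true  r = + r
signed false r = ℤ.- + r

sign : Bool → ℤ
sign b = signed b 1

signedDigits : ∀ {n} → (Fin n → ℕ) → Subset n → Fin n → ℤ
signedDigits r J i = signed (lookup J i) (r i)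

sign≢0 : ∀ b → sign b ≢ + 0
sign≢0 true  ()
sign≢0 false ()

sign-injective : ∀ {b b′} → sign b ≡ sign b′ → b ≡ b′
sign-injective {true}  {true}  _ = refl
sign-injective {true}  {false} ()
sign-injective {false} {true}  ()
sign-injective {false} {false} _ = refl

-sign≡sign-not : ∀ b → ℤ.- sign b ≡ sign (not b)
-sign≡sign-not true  = refl
-sign≡sign-not false = refl

signed-+ : ∀ b m n → signed b m ℤ.+ signed b n ≡ signed b (m + n)
signed-+ true  m n = sym (ℤP.pos-+ m n)
signed-+ false m n = trans (sym (ℤP.neg-distrib-+ (+ m) (+ n))) (cong ℤ.-_ (sym (ℤP.pos-+ m n)))

signed-not : ∀ b r → signed (not b) r ≡ ℤ.- signed b r
signed-not true  r = refl
signed-not false r = sym (ℤP.neg-involutive (+ r))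

p*sign : ∀ p b → + p ℤ.* sign b ≡ signed b p
p*sign p true  = ℤP.*-identityʳ (+ p)
p*sign p false = trans (sym (ℤP.neg-distribʳ-* (+ p) (+ 1))) (cong ℤ.-_ (ℤP.*-identityʳ (+ p)))

signed-negate : ∀ {z} → signed b r ℤ.+ y ≡ z → signed (not b) r ℤ.+ ℤ.- y ≡ ℤ.- z
signed-negate {b} {r} {y} eq = begin
  signed (not b) r ℤ.+ ℤ.- y   ≡⟨ cong (ℤ._+ ℤ.- y) (signed-not b r) ⟩
  ℤ.- signed b r ℤ.+ ℤ.- y     ≡⟨ sym (ℤP.neg-distrib-+ (signed b r) y) ⟩
  ℤ.- (signed b r ℤ.+ y)       ≡⟨ cong ℤ.-_ eq ⟩
  _                            ∎
  where open ≡-Reasoning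

data Transition (p : ℕ) : ℕ → Bool → ℤ → ℤ → Set where
  digit-one    : Transition p 1       b (+ 0)    (ℤ.- sign b)
  digit-p      : Transition p p       b (sign b) (+ 0)
  digit-pred-p : Transition p (p ∸ 1) b (sign b) (sign b)

digit-one′ : r ≡ 1 → x ≡ + 0 → y ≡ ℤ.- sign b → Transition p r b x y
digit-one′ refl refl refl = digit-one

digit-p′ : r ≡ p → x ≡ sign b → y ≡ + 0 → Transition p r b x y
digit-p′ refl refl refl = digit-p

digit-pred-p′ : r ≡ p ∸ 1 → x ≡ sign b → y ≡ sign b → Transition p r b x y
digit-pred-p′ refl refl refl = digit-pred-p

Transition⇒equation : 1 ≤ p → Transition p r b x y → signed b r ℤ.+ y ≡ + p ℤ.* x
Transition⇒equation {p} _   (digit-one {b})    = trans (ℤP.+-inverseʳ (sign b)) (sym (ℤP.*-zeroʳ (+ p)))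
Transition⇒equation {p} _   (digit-p {b})      = trans (ℤP.+-identityʳ (signed b p)) (sym (p*sign p b))
Transition⇒equation {p} p≥1 (digit-pred-p {b}) =
  trans (signed-+ b (p ∸ 1) 1) (trans (cong (signed b) (ℕP.m∸n+n≡m p≥1)) (sym (p*sign p b)))

Transition-negate : Transition p r true x y → Transition p r false (ℤ.- x) (ℤ.- y)
Transition-negate digit-one    = digit-one
Transition-negate digit-p      = digit-p
Transition-negate digit-pred-p = digit-pred-p

equation⇒Transition⁺ : 2 ≤ p → 1 ≤ r → r ≤ p → ℤ.∣ x ∣ ≤ 1 → ℤ.∣ y ∣ ≤ 1 →
                       + r ℤ.+ y ≡ + p ℤ.* x → Transition p r true x y
equation⇒Transition⁺ {p} {x = + 0} _ r≥1 _ _ ∣y∣≤1 eq = carry-zero r≥1 ∣y∣≤1 (trans eq (ℤP.*-zeroʳ (+ p)))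
  where
    carry-zero : ∀ {r y} → 1 ≤ r → ℤ.∣ y ∣ ≤ 1 → + r ℤ.+ y ≡ + 0 → Transition p r true (+ 0) y
    carry-zero {y = -[1+ 0 ]}       (s≤s z≤n) _ refl = digit-one
    carry-zero {y = + 0}            (s≤s z≤n) _ ()
    carry-zero {y = + 1}            (s≤s z≤n) _ ()
    carry-zero {y = + suc (suc _)}  _ (s≤s ())
    carry-zero {y = -[1+ suc _ ]}   _ (s≤s ())
equation⇒Transition⁺ {p} {x = + 1} _ r≥1 r≤p _ ∣y∣≤1 eq =
  carry-one r≥1 r≤p ∣y∣≤1 (trans eq (ℤP.*-identityʳ (+ p)))
  where
    carry-one : ∀ {r y} → 1 ≤ r → r ≤ p → ℤ.∣ y ∣ ≤ 1 → + r ℤ.+ y ≡ + p → Transition p r true (+ 1) y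
    carry-one {r} {+ 0} _ _ _ eq = digit-p′ (trans (sym (ℕP.+-identityʳ r)) (ℤP.+-injective eq)) refl refl
    carry-one {r} {+ 1} _ _ _ eq =
      digit-pred-p′ (trans (sym (ℕP.m+n∸n≡m r 1)) (cong (_∸ 1) (ℤP.+-injective eq))) refl refl
    carry-one {y = -[1+ 0 ]}     (s≤s z≤n) r≤p _ eq = ⊥-elim (ℕP.<-irrefl (ℤP.+-injective eq) r≤p)
    carry-one {y = + suc (suc _)} _ _ (s≤s ())
    carry-one {y = -[1+ suc _ ]}  _ _ (s≤s ())
equation⇒Transition⁺ {p} {x = -[1+ 0 ]} {y} p≥2 r≥1 _ _ ∣y∣≤1 eq =
  ⊥-elim (carry-minus-one {y = y} p≥2 r≥1 ∣y∣≤1 (trans eq (p*sign p false)))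
  where
    carry-minus-one : ∀ {p r y} → 2 ≤ p → 1 ≤ r → ℤ.∣ y ∣ ≤ 1 → ¬ (+ r ℤ.+ y ≡ ℤ.- + p)
    carry-minus-one {y = + 0}           (s≤s (s≤s z≤n)) (s≤s z≤n) _ ()
    carry-minus-one {y = + 1}           (s≤s (s≤s z≤n)) (s≤s z≤n) _ ()
    carry-minus-one {y = -[1+ 0 ]}      (s≤s (s≤s z≤n)) (s≤s z≤n) _ ()
    carry-minus-one {y = + suc (suc _)} _ _ (s≤s ())
    carry-minus-one {y = -[1+ suc _ ]}  _ _ (s≤s ())
equation⇒Transition⁺ {x = + suc (suc _)} _ _ _ (s≤s ()) _ _
equation⇒Transition⁺ {x = -[1+ suc _ ]}  _ _ _ (s≤s ()) _ _

equation⇒Transition : 2 ≤ p → 1 ≤ r → r ≤ p → ℤ.∣ x ∣ ≤ 1 → ℤ.∣ y ∣ ≤ 1 →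
                      signed b r ℤ.+ y ≡ + p ℤ.* x → Transition p r b x y
equation⇒Transition {b = true} = equation⇒Transition⁺
equation⇒Transition {p} {r} {x} {y} {false} p≥2 r≥1 r≤p ∣x∣≤1 ∣y∣≤1 eq =
  subst₂ (Transition p r false) (ℤP.neg-involutive x) (ℤP.neg-involutive y)
    (Transition-negate (equation⇒Transition⁺ {y = ℤ.- y} p≥2 r≥1 r≤p
      (subst (_≤ 1) (sym (ℤP.∣-i∣≡∣i∣ x)) ∣x∣≤1) (subst (_≤ 1) (sym (ℤP.∣-i∣≡∣i∣ y)) ∣y∣≤1)
      (trans (signed-negate {false} {r} {y} eq) (ℤP.neg-distribʳ-* (+ p) x))))

p∸1≢p : 1 ≤ p → p ∸ 1 ≢ p
p∸1≢p {suc q} _ eq = ℕP.1+n≢n (sym eq)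

low-digit≢p : 2 ≤ p → r ≡ 1 ⊎ r ≡ p ∸ 1 → r ≢ p
low-digit≢p p≥2 (inj₁ refl) = ℕP.<⇒≢ p≥2
low-digit≢p p≥2 (inj₂ refl) = p∸1≢p (ℕP.<⇒≤ p≥2)

digit≢p⇒low : r ≡ 1 ⊎ r ≡ p ∸ 1 ⊎ r ≡ p → r ≢ p → r ≡ 1 ⊎ r ≡ p ∸ 1
digit≢p⇒low (inj₁ r≡1)          _   = inj₁ r≡1
digit≢p⇒low (inj₂ (inj₁ r≡p-1)) _   = inj₂ r≡p-1
digit≢p⇒low (inj₂ (inj₂ r≡p))   r≢p = ⊥-elim (r≢p r≡p)

Transition-digit : Transition p r b x y → r ≡ 1 ⊎ r ≡ p ∸ 1 ⊎ r ≡ p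
Transition-digit digit-one    = inj₁ refl
Transition-digit digit-pred-p = inj₂ (inj₁ refl)
Transition-digit digit-p      = inj₂ (inj₂ refl)

carry-in-zero : Transition p r b x y → x ≡ + 0 → r ≡ 1 × y ≡ ℤ.- sign b
carry-in-zero digit-one          _   = refl , refl
carry-in-zero (digit-p {b})      x≡0 = ⊥-elim (sign≢0 b x≡0)
carry-in-zero (digit-pred-p {b}) x≡0 = ⊥-elim (sign≢0 b x≡0)

carry-in-nonzero⇒sign : Transition p r b x y → x ≢ + 0 → x ≡ sign b
carry-in-nonzero⇒sign digit-one    x≢0 = ⊥-elim (x≢0 refl)
carry-in-nonzero⇒sign digit-p      _   = refl
carry-in-nonzero⇒sign digit-pred-p _   = refl

carry-in-nonzero⇒digit : Transition p r b x y → x ≢ + 0 → r ≡ p ∸ 1 ⊎ r ≡ p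
carry-in-nonzero⇒digit digit-one    x≢0 = ⊥-elim (x≢0 refl)
carry-in-nonzero⇒digit digit-p      _   = inj₂ refl
carry-in-nonzero⇒digit digit-pred-p _   = inj₁ refl

carry-out-zero⇒digit-p : Transition p r b x y → y ≡ + 0 → r ≡ p
carry-out-zero⇒digit-p (digit-one {b})    y≡0 = ⊥-elim (sign≢0 (not b) (trans (sym (-sign≡sign-not b)) y≡0))
carry-out-zero⇒digit-p digit-p            _   = refl
carry-out-zero⇒digit-p (digit-pred-p {b}) y≡0 = ⊥-elim (sign≢0 b y≡0)

digit-p⇒carry-out-zero : 2 ≤ p → Transition p r b x y → r ≡ p → y ≡ + 0
digit-p⇒carry-out-zero p≥2 digit-one    1≡p   = ⊥-elim (ℕP.<⇒≢ p≥2 1≡p)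
digit-p⇒carry-out-zero _   digit-p      _     = refl
digit-p⇒carry-out-zero p≥2 digit-pred-p p∸1≡p = ⊥-elim (p∸1≢p (ℕP.<⇒≤ p≥2) p∸1≡p)

carry-propagates : Transition p r b x y → r ≢ p → x ≢ + 0 → y ≡ x
carry-propagates digit-one    _   x≢0 = ⊥-elim (x≢0 refl)
carry-propagates digit-p      r≢p _   = ⊥-elim (r≢p refl)
carry-propagates digit-pred-p _   _   = refl

lookup≡⇒∈⇔∈ : ∀ {n} (J : Subset n) {i j} → lookup J j ≡ lookup J i → (j ∈ J ⇔ i ∈ J)
lookup≡⇒∈⇔∈ J {i} {j} eq = mk⇔ (λ j∈J → lookup⇒[]= i J (trans (sym eq) ([]=⇒lookup j∈J)))
                               (λ i∈J → lookup⇒[]= j J (trans eq ([]=⇒lookup i∈J)))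

lookup≡not⇒∈⇔∉ : ∀ {n} (J : Subset n) {i j} → lookup J j ≡ not (lookup J i) → (j ∈ J ⇔ i ∉ J)
lookup≡not⇒∈⇔∉ J {i} {j} eq = mk⇔ to from
  where
    to : j ∈ J → i ∉ J
    to j∈J i∈J with () ← trans (sym ([]=⇒lookup j∈J)) (trans eq (cong not ([]=⇒lookup i∈J)))
    from : i ∉ J → j ∈ J
    from i∉J with lookup J i in eqᵢ
    ... | true  = ⊥-elim (i∉J (lookup⇒[]= i J eqᵢ))
    ... | false = lookup⇒[]= j J eq

∈⇔∈⇒lookup≡ : ∀ {n} (J : Subset n) {i j} → (j ∈ J ⇔ i ∈ J) → lookup J j ≡ lookup J i
∈⇔∈⇒lookup≡ J {i} {j} j⇔i with lookup J i in eqᵢ | lookup J j in eqⱼ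
... | true  | true  = refl
... | false | false = refl
... | true  | false = trans (sym eqⱼ) ([]=⇒lookup (Equivalence.from j⇔i (lookup⇒[]= i J eqᵢ)))
... | false | true  = trans (sym ([]=⇒lookup (Equivalence.to j⇔i (lookup⇒[]= j J eqⱼ)))) eqᵢ

∈⇔∉⇒lookup≡not : ∀ {n} (J : Subset n) {i j} → (j ∈ J ⇔ i ∉ J) → lookup J j ≡ not (lookup J i)
∈⇔∉⇒lookup≡not J {i} {j} j⇔i∉ with lookup J i in eqᵢ | lookup J j in eqⱼ
... | true  | false = refl
... | false | true  = refl
... | true  | true  = ⊥-elim (Equivalence.to j⇔i∉ (lookup⇒[]= j J eqⱼ) (lookup⇒[]= i J eqᵢ))
... | false | false = trans (sym eqⱼ) ([]=⇒lookup (Equivalence.from j⇔i∉ i∉J))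
  where
    i∉J : i ∉ J
    i∉J i∈J with () ← trans (sym eqᵢ) ([]=⇒lookup i∈J)

lookup-constant : ∀ {A : Set} {n} (xs : Vec A n) {a} → (∀ i → lookup xs i ≡ a) → xs ≡ replicate n a
lookup-constant []       _  = refl
lookup-constant (x ∷ xs) eq = cong₂ _∷_ (eq F.zero) (lookup-constant xs (eq ∘ F.suc))

-- From a carry to the digit pattern

module _ {p k} {r : Fin (suc k) → ℕ} {J : Subset (suc k)} {c : Fin (suc k) → ℤ}
         (p≥2 : 2 ≤ p) (T : ∀ i → Transition p (r i) (lookup J i) (c i) (c (sucMod i))) where

  transitions⇒InP : InP p r
  transitions⇒InP i =
      Transition-digit (T i)
    , (λ ri≡p → proj₁ (carry-in-zero (T (sucMod i)) (digit-p⇒carry-out-zero p≥2 (T i) ri≡p)))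
    , (λ ri-low → carry-in-nonzero⇒digit (T (sucMod i))
                     (low-digit≢p p≥2 ri-low ∘ carry-out-zero⇒digit-p (T i)))

  transitions⇒JCond : JCond p r J
  transitions⇒JCond i = after-p , after-low
    where
      open ≡-Reasoning
      j = predMod i
      T-pred : Transition p (r j) (lookup J j) (c j) (c i)
      T-pred = subst (λ i′ → Transition p (r j) (lookup J j) (c j) (c i′)) (sucMod-predMod i) (T j)
      sign-next : c (sucMod i) ≢ + 0 → sign (lookup J (sucMod i)) ≡ c (sucMod i)
      sign-next c′≢0 = sym (carry-in-nonzero⇒sign (T (sucMod i)) c′≢0)

      after-p : r j ≡ p × r i ≡ 1 → (sucMod i ∈ J ⇔ i ∉ J)
      after-p (rj≡p , _) = lookup≡not⇒∈⇔∉ J (sign-injective (begin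
          sign (lookup J (sucMod i))   ≡⟨ sign-next c′≢0 ⟩
          c (sucMod i)                 ≡⟨ c′≡ ⟩
          ℤ.- sign (lookup J i)        ≡⟨ -sign≡sign-not (lookup J i) ⟩
          sign (not (lookup J i))      ∎))
        where
          c′≡ : c (sucMod i) ≡ ℤ.- sign (lookup J i)
          c′≡ = proj₂ (carry-in-zero (T i) (digit-p⇒carry-out-zero p≥2 T-pred rj≡p))
          c′≢0 : c (sucMod i) ≢ + 0
          c′≢0 c′≡0 =
            sign≢0 (not (lookup J i)) (trans (sym (-sign≡sign-not (lookup J i))) (trans (sym c′≡) c′≡0))

      after-low : (r j ≡ 1 × r i ≡ p ∸ 1) ⊎ (r j ≡ p ∸ 1 × r i ≡ p ∸ 1) → (sucMod i ∈ J ⇔ i ∈ J)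
      after-low h = lookup≡⇒∈⇔∈ J (sign-injective (begin
          sign (lookup J (sucMod i))   ≡⟨ sign-next (ci≢0 ∘ trans (sym c′≡c)) ⟩
          c (sucMod i)                 ≡⟨ c′≡c ⟩
          c i                          ≡⟨ carry-in-nonzero⇒sign (T i) ci≢0 ⟩
          sign (lookup J i)            ∎))
        where
          ci≢0 : c i ≢ + 0
          ci≢0 = low-digit≢p p≥2 (Sum.map proj₁ proj₁ h) ∘ carry-out-zero⇒digit-p T-pred
          c′≡c : c (sucMod i) ≡ c i
          c′≡c = carry-propagates (T i) (low-digit≢p p≥2 (inj₂ (Sum.[ proj₂ , proj₂ ] h))) ci≢0

∣signed∣ : ∀ b r → ℤ.∣ signed b r ∣ ≡ r
∣signed∣ true  r = refl
∣signed∣ false r = ℤP.∣-i∣≡∣i∣ (+ r)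

signed-∣∣ : ∀ x → ∃ λ b → x ≡ signed b ℤ.∣ x ∣
signed-∣∣ (+ n)     = true , refl
signed-∣∣ -[1+ n ]  = false , refl

argmax-Fin : ∀ {n} (g : Fin (suc n) → ℕ) → ∃ λ m → ∀ j → g j ≤ g m
argmax-Fin {n} g = argmax g F.zero (allFin (suc n))
                 , λ j → All.lookup (f[xs]≤f[argmax] {f = g} F.zero (allFin (suc n))) (∈-allFin j)

carry-bound : ∀ {p k} {d c : Fin (suc k) → ℤ} → IsCarry p d c →
              ∀ m → (∀ j → ℤ.∣ c j ∣ ≤ ℤ.∣ c m ∣) → p * ℤ.∣ c m ∣ ≤ ℤ.∣ d m ∣ + ℤ.∣ c m ∣
carry-bound {p} {d = d} {c} carry m max = begin
  p * ℤ.∣ c m ∣                       ≡⟨ sym (ℤP.abs-* (+ p) (c m)) ⟩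
  ℤ.∣ + p ℤ.* c m ∣                   ≡⟨ cong ℤ.∣_∣ (sym (carry m)) ⟩
  ℤ.∣ d m ℤ.+ c (sucMod m) ∣          ≤⟨ ℤP.∣i+j∣≤∣i∣+∣j∣ (d m) (c (sucMod m)) ⟩
  ℤ.∣ d m ∣ + ℤ.∣ c (sucMod m) ∣      ≤⟨ ℕP.+-monoʳ-≤ ℤ.∣ d m ∣ (max (sucMod m)) ⟩
  ℤ.∣ d m ∣ + ℤ.∣ c m ∣               ∎
  where open ℕP.≤-Reasoning

*≤+⇒≤1⊎≡2 : ∀ {m n} → 2 ≤ m → m * n ≤ m + n → n ≤ 1 ⊎ (m ≡ 2 × n ≡ 2)
*≤+⇒≤1⊎≡2 {n = zero}                     _ _ = inj₁ z≤n
*≤+⇒≤1⊎≡2 {n = suc zero}                 _ _ = inj₁ ℕP.≤-refl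
*≤+⇒≤1⊎≡2 {suc zero}    {suc (suc _)} (s≤s ()) _
*≤+⇒≤1⊎≡2 {suc (suc q)} {suc (suc n)} _ mn≤m+n =
  inj₂ (cong (λ x → 2 + x) (ℕP.m+n≡0⇒m≡0 q q+n≡0) , cong (λ x → 2 + x) (ℕP.m+n≡0⇒n≡0 q q+n≡0))
  where
    expand : ∀ q n → (2 + q) * (2 + n) ≡ (2 + q + (2 + n)) + (q + n + q * n)
    expand = solve-∀ℕ
    excess≤0 : q + n + q * n ≤ 0
    excess≤0 = ℕP.+-cancelˡ-≤ (2 + q + (2 + n)) _ 0
      (subst₂ _≤_ (expand q n) (sym (ℕP.+-identityʳ _)) mn≤m+n)
    q+n≡0 : q + n ≡ 0
    q+n≡0 = ℕP.m+n≡0⇒m≡0 (q + n) (ℕP.n≤0⇒n≡0 excess≤0)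

two-carry-step⁺ : 1 ≤ r → r ≤ 2 → ℤ.∣ y ∣ ≤ 2 → signed b r ℤ.+ y ≡ + 4 → b ≡ true × r ≡ 2 × y ≡ + 2
two-carry-step⁺ {2} {+ 2}        {true}  _ _ _ _  = refl , refl , refl
two-carry-step⁺ {1} {+ 0}        {true}  _ _ _ ()
two-carry-step⁺ {1} {+ 1}        {true}  _ _ _ ()
two-carry-step⁺ {1} {+ 2}        {true}  _ _ _ ()
two-carry-step⁺ {1} { -[1+ 0 ] } {true}  _ _ _ ()
two-carry-step⁺ {1} { -[1+ 1 ] } {true}  _ _ _ ()
two-carry-step⁺ {2} {+ 0}        {true}  _ _ _ ()
two-carry-step⁺ {2} {+ 1}        {true}  _ _ _ ()
two-carry-step⁺ {2} { -[1+ 0 ] } {true}  _ _ _ ()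
two-carry-step⁺ {2} { -[1+ 1 ] } {true}  _ _ _ ()
two-carry-step⁺ {1} {+ 0}        {false} _ _ _ ()
two-carry-step⁺ {1} {+ 1}        {false} _ _ _ ()
two-carry-step⁺ {1} {+ 2}        {false} _ _ _ ()
two-carry-step⁺ {1} { -[1+ 0 ] } {false} _ _ _ ()
two-carry-step⁺ {1} { -[1+ 1 ] } {false} _ _ _ ()
two-carry-step⁺ {2} {+ 0}        {false} _ _ _ ()
two-carry-step⁺ {2} {+ 1}        {false} _ _ _ ()
two-carry-step⁺ {2} {+ 2}        {false} _ _ _ ()
two-carry-step⁺ {2} { -[1+ 0 ] } {false} _ _ _ ()
two-carry-step⁺ {2} { -[1+ 1 ] } {false} _ _ _ ()
two-carry-step⁺ {zero}                ()
two-carry-step⁺ {suc (suc (suc _))}   _ (s≤s (s≤s ()))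
two-carry-step⁺ {y = + suc (suc (suc _))} _ _ (s≤s (s≤s ()))
two-carry-step⁺ {y = -[1+ suc (suc _) ]}  _ _ (s≤s (s≤s ()))

two-carry-step : ∀ b′ → 1 ≤ r → r ≤ 2 → ℤ.∣ y ∣ ≤ 2 →
                 signed b r ℤ.+ y ≡ + 2 ℤ.* signed b′ 2 → b ≡ b′ × r ≡ 2 × y ≡ signed b′ 2
two-carry-step true r≥1 r≤2 ∣y∣≤2 eq = two-carry-step⁺ r≥1 r≤2 ∣y∣≤2 eq
two-carry-step {r} {y} {b} false r≥1 r≤2 ∣y∣≤2 eq
  with b≡ , r≡2 , -y≡2 ← two-carry-step⁺ {y = ℤ.- y} r≥1 r≤2 (subst (_≤ 2) (sym (ℤP.∣-i∣≡∣i∣ y)) ∣y∣≤2)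
                                          (signed-negate {b} {r} {y} eq)
  = trans (sym (not-involutive b)) (cong not b≡) , r≡2 , trans (sym (ℤP.neg-involutive y)) (cong ℤ.-_ -y≡2)

replicate-bool : ∀ {n} b → replicate n b ≡ ⊥ ⊎ replicate n b ≡ ⊤
replicate-bool true  = inj₂ refl
replicate-bool false = inj₁ refl

module _ {k} {r : Fin (suc k) → ℕ} {J : Subset (suc k)} {c : Fin (suc k) → ℤ}
         (bounds : ∀ i → 1 ≤ r i × r i ≤ 2) (carry : IsCarry 2 (signedDigits r J) c)
         (∣c∣≤2 : ∀ i → ℤ.∣ c i ∣ ≤ 2) where

  carry-two⇒exceptional : ∀ m → ℤ.∣ c m ∣ ≡ 2 → (∀ i → r i ≡ 2) × (J ≡ ⊥ ⊎ J ≡ ⊤)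
  carry-two⇒exceptional m ∣cm∣≡2 =
      (λ i → proj₁ (proj₂ (step i (all i))))
    , subst (λ J′ → J′ ≡ ⊥ ⊎ J′ ≡ ⊤) (sym (lookup-constant J (λ i → proj₁ (step i (all i)))))
            (replicate-bool bₘ)
    where
      bₘ = proj₁ (signed-∣∣ (c m))
      step : ∀ i → c i ≡ signed bₘ 2 → lookup J i ≡ bₘ × r i ≡ 2 × c (sucMod i) ≡ signed bₘ 2
      step i ci≡ = two-carry-step bₘ (proj₁ (bounds i)) (proj₂ (bounds i)) (∣c∣≤2 (sucMod i))
                     (trans (carry i) (cong (+ 2 ℤ.*_) ci≡))
      all : ∀ i → c i ≡ signed bₘ 2
      all = sucMod-induction (λ i → c i ≡ signed bₘ 2) (λ i → proj₂ ∘ proj₂ ∘ step i) m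
              (trans (proj₂ (signed-∣∣ (c m))) (cong (signed bₘ) ∣cm∣≡2))

carry⇒conditions : ∀ {p k} {r : Fin (suc k) → ℕ} {J : Subset (suc k)} {c : Fin (suc k) → ℤ} →
                   2 ≤ p → (∀ i → 1 ≤ r i × r i ≤ p) → IsCarry p (signedDigits r J) c →
                   (InP p r × JCond p r J) ⊎ (p ≡ 2 × (∀ i → r i ≡ 2) × (J ≡ ⊥ ⊎ J ≡ ⊤))
carry⇒conditions {p} {r = r} {J} {c} p≥2 bounds carry = by-size (*≤+⇒≤1⊎≡2 p≥2 bound)
  where
    m = proj₁ (argmax-Fin (ℤ.∣_∣ ∘ c))
    max = proj₂ (argmax-Fin (ℤ.∣_∣ ∘ c))
    bound : p * ℤ.∣ c m ∣ ≤ p + ℤ.∣ c m ∣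
    bound = ℕP.≤-trans (carry-bound {p} {d = signedDigits r J} carry m max)
              (ℕP.+-monoˡ-≤ ℤ.∣ c m ∣ (subst (_≤ p) (sym (∣signed∣ (lookup J m) (r m))) (proj₂ (bounds m))))
    by-size : ℤ.∣ c m ∣ ≤ 1 ⊎ (p ≡ 2 × ℤ.∣ c m ∣ ≡ 2) →
              (InP p r × JCond p r J) ⊎ (p ≡ 2 × (∀ i → r i ≡ 2) × (J ≡ ⊥ ⊎ J ≡ ⊤))
    by-size (inj₁ ∣cm∣≤1) = inj₁ (transitions⇒InP {J = J} p≥2 T , transitions⇒JCond p≥2 T)
      where
        T : ∀ i → Transition p (r i) (lookup J i) (c i) (c (sucMod i))
        T i = equation⇒Transition p≥2 (proj₁ (bounds i)) (proj₂ (bounds i))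
                (ℕP.≤-trans (max i) ∣cm∣≤1) (ℕP.≤-trans (max (sucMod i)) ∣cm∣≤1) (carry i)
    by-size (inj₂ (p≡2 , ∣cm∣≡2)) = inj₂ (p≡2 , carry-two⇒exceptional bounds₂ carry₂ ∣c∣≤2 m ∣cm∣≡2)
      where
        bounds₂ : ∀ i → 1 ≤ r i × r i ≤ 2
        bounds₂ i = subst (λ q → 1 ≤ r i × r i ≤ q) p≡2 (bounds i)
        carry₂ : IsCarry 2 (signedDigits r J) c
        carry₂ = subst (λ q → IsCarry q (signedDigits r J) c) p≡2 carry
        ∣c∣≤2 : ∀ i → ℤ.∣ c i ∣ ≤ 2
        ∣c∣≤2 i = ℕP.≤-trans (max i) (ℕP.≤-reflexive ∣cm∣≡2)

-- From the digit pattern to a carry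

module _ {p k : ℕ} (r : Fin (suc k) → ℕ) (J : Subset (suc k)) where

  canonicalCarry : Fin (suc k) → ℤ
  canonicalCarry i with r (predMod i) ℕ.≟ p
  ... | yes _ = + 0
  ... | no  _ = sign (lookup J i)

  canonicalCarry-after-p : ∀ i → r (predMod i) ≡ p → canonicalCarry i ≡ + 0
  canonicalCarry-after-p i rj≡p with r (predMod i) ℕ.≟ p
  ... | yes _    = refl
  ... | no  rj≢p = ⊥-elim (rj≢p rj≡p)

  canonicalCarry-not-after-p : ∀ i → r (predMod i) ≢ p → canonicalCarry i ≡ sign (lookup J i)
  canonicalCarry-not-after-p i rj≢p with r (predMod i) ℕ.≟ p
  ... | yes rj≡p = ⊥-elim (rj≢p rj≡p)
  ... | no  _    = refl

  canonicalCarry-next-p : ∀ i → r i ≡ p → canonicalCarry (sucMod i) ≡ + 0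
  canonicalCarry-next-p i ri≡p = canonicalCarry-after-p (sucMod i) (trans (cong r (predMod-sucMod i)) ri≡p)

  canonicalCarry-next-not-p : ∀ i → r i ≢ p → canonicalCarry (sucMod i) ≡ sign (lookup J (sucMod i))
  canonicalCarry-next-not-p i ri≢p =
    canonicalCarry-not-after-p (sucMod i) (ri≢p ∘ trans (sym (cong r (predMod-sucMod i))))

  conditions⇒Transition : 2 ≤ p → InP p r → JCond p r J →
                          ∀ i → Transition p (r i) (lookup J i) (canonicalCarry i) (canonicalCarry (sucMod i))
  conditions⇒Transition p≥2 inP jcond i = by-predecessor (r j ℕ.≟ p)
    where
      open ≡-Reasoning
      j = predMod i
      r-next-j : r (sucMod j) ≡ r i
      r-next-j = cong r (sucMod-predMod i)
      rj-low : r j ≢ p → r j ≡ 1 ⊎ r j ≡ p ∸ 1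
      rj-low = digit≢p⇒low (proj₁ (inP j))

      by-predecessor : Dec (r j ≡ p) →
                       Transition p (r i) (lookup J i) (canonicalCarry i) (canonicalCarry (sucMod i))
      by-predecessor (yes rj≡p) = digit-one′ ri≡1 (canonicalCarry-after-p i rj≡p) (begin
          canonicalCarry (sucMod i)     ≡⟨ canonicalCarry-next-not-p i (low-digit≢p p≥2 (inj₁ ri≡1)) ⟩
          sign (lookup J (sucMod i))    ≡⟨ cong sign (∈⇔∉⇒lookup≡not J (proj₁ (jcond i) (rj≡p , ri≡1))) ⟩
          sign (not (lookup J i))       ≡⟨ sym (-sign≡sign-not (lookup J i)) ⟩
          ℤ.- sign (lookup J i)         ∎)
        where
          ri≡1 : r i ≡ 1
          ri≡1 = trans (sym r-next-j) (proj₁ (proj₂ (inP j)) rj≡p)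
      by-predecessor (no rj≢p) with proj₂ (proj₂ (inP j)) (rj-low rj≢p)
      ... | inj₂ r-next≡p = digit-p′ ri≡p (canonicalCarry-not-after-p i rj≢p) (canonicalCarry-next-p i ri≡p)
        where
          ri≡p : r i ≡ p
          ri≡p = trans (sym r-next-j) r-next≡p
      ... | inj₁ r-next≡p-1 = digit-pred-p′ ri≡p-1 (canonicalCarry-not-after-p i rj≢p) (begin
          canonicalCarry (sucMod i)     ≡⟨ canonicalCarry-next-not-p i (low-digit≢p p≥2 (inj₂ ri≡p-1)) ⟩
          sign (lookup J (sucMod i))    ≡⟨ cong sign (∈⇔∈⇒lookup≡ J (proj₂ (jcond i) low-then-p-1)) ⟩
          sign (lookup J i)             ∎)
        where
          ri≡p-1 : r i ≡ p ∸ 1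
          ri≡p-1 = trans (sym r-next-j) r-next≡p-1
          low-then-p-1 : (r j ≡ 1 × r i ≡ p ∸ 1) ⊎ (r j ≡ p ∸ 1 × r i ≡ p ∸ 1)
          low-then-p-1 = Sum.map (_, ri≡p-1) (_, ri≡p-1) (rj-low rj≢p)

constant-carry : ∀ {k} {r : Fin (suc k) → ℕ} {J : Subset (suc k)} b →
                 (∀ i → r i ≡ 2) → (∀ i → lookup J i ≡ b) → IsCarry 2 (signedDigits r J) (λ _ → signed b 2)
constant-carry b r≡2 J≡b i rewrite J≡b i | r≡2 i = doubling b
  where
    doubling : ∀ b → signed b 2 ℤ.+ signed b 2 ≡ + 2 ℤ.* signed b 2
    doubling true  = refl
    doubling false = refl

conditions⇒carry : ∀ {p k} {r : Fin (suc k) → ℕ} {J : Subset (suc k)} → 2 ≤ p →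
                   (InP p r × JCond p r J) ⊎ (p ≡ 2 × (∀ i → r i ≡ 2) × (J ≡ ⊥ ⊎ J ≡ ⊤)) →
                   ∃ (IsCarry p (signedDigits r J))
conditions⇒carry {r = r} {J} p≥2 (inj₁ (inP , jcond)) =
  canonicalCarry r J , λ i → Transition⇒equation (ℕP.<⇒≤ p≥2) (conditions⇒Transition r J p≥2 inP jcond i)
conditions⇒carry _ (inj₂ (refl , r≡2 , inj₁ refl)) =
  (λ _ → signed false 2) , constant-carry {J = ⊥} false r≡2 (λ i → lookup-replicate i false)
conditions⇒carry _ (inj₂ (refl , r≡2 , inj₂ refl)) =
  (λ _ → signed true 2) , constant-carry {J = ⊤} true r≡2 (λ i → lookup-replicate i true)

-- The two sums as one signed Horner sum

ΣFin≡horner : ∀ p k (g : Fin (suc k) → ℕ) →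
              + ΣFin (suc k) (λ i → p ^ (k ∸ toℕ i) * g i) ≡ horner p k (λ n → + g (n mod suc k))
ΣFin≡horner p k g = trans
  (cong +_ (ΣFin-cong (suc k) (λ i → cong (λ j → p ^ (k ∸ toℕ i) * g j) (sym (mod-toℕ i)))))
  (ΣFin-toℕ≡horner p k (λ n → g (n mod suc k)))

hvec-difference : ∀ {n} (r : Fin n → ℕ) J i → + hvec r J i ℤ.- + (r i ∸ hvec r J i) ≡ signedDigits r J i
hvec-difference r J i with lookup J i
... | true  = trans (cong (λ x → + r i ℤ.- + x) (ℕP.n∸n≡0 (r i))) (ℤP.+-identityʳ (+ r i))
... | false = ℤP.+-identityˡ (ℤ.- + r i)

ΣFin-difference≡horner : ∀ p k (r : Fin (suc k) → ℕ) J →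
  + ΣFin (suc k) (λ i → p ^ (k ∸ toℕ i) * hvec r J i)
    ℤ.- + ΣFin (suc k) (λ i → p ^ (k ∸ toℕ i) * (r i ∸ hvec r J i))
  ≡ horner p k (λ n → signedDigits r J (n mod suc k))
ΣFin-difference≡horner p k r J = begin
    + ΣFin (suc k) (λ i → p ^ (k ∸ toℕ i) * h i) ℤ.- + ΣFin (suc k) (λ i → p ^ (k ∸ toℕ i) * (r i ∸ h i))
  ≡⟨ cong₂ ℤ._-_ (ΣFin≡horner p k h) (ΣFin≡horner p k (λ i → r i ∸ h i)) ⟩
    horner p k (λ n → + h (n mod suc k)) ℤ.- horner p k (λ n → + (r (n mod suc k) ∸ h (n mod suc k)))
  ≡⟨ horner-sub p k _ _ ⟩
    horner p k (λ n → + h (n mod suc k) ℤ.- + (r (n mod suc k) ∸ h (n mod suc k)))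
  ≡⟨ horner-cong p k (λ n → hvec-difference r J (n mod suc k)) ⟩
    horner p k (λ n → signedDigits r J (n mod suc k)) ∎
  where
    open ≡-Reasoning
    h = hvec r J

lemma7p3 : (p k : ℕ) → Prime p → (r : Fin (suc k) → ℕ) → (∀ i → 1 ≤ r i × r i ≤ p) → (J : Subset (suc k)) →
    (ΣFin (suc k) (λ i → p ^ (k ∸ toℕ i) * hvec r J i)
       ≡ ΣFin (suc k) (λ i → p ^ (k ∸ toℕ i) * (r i ∸ hvec r J i)) [mod (p ^ suc k ∸ 1) ]
     ⇔ ((InP p r × JCond p r J) ⊎ (p ≡ 2 × (∀ i → r i ≡ 2) × (J ≡ ⊥ ⊎ J ≡ ⊤))))
lemma7p3 p k p-prime r bounds J = mk⇔
  (λ N∣A-B → carry⇒conditions p≥2 bounds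
               (proj₂ (divides⇒carry p k {{p≢0}} digits (subst (N ∣ℤ_) difference N∣A-B))))
  (λ conditions → subst (N ∣ℤ_) (sym difference)
                    (carry⇒divides p k {{p≢0}} digits (proj₂ (conditions⇒carry p≥2 conditions))))
  where
    p≢0 = prime⇒nonZero p-prime
    p≥2 : 2 ≤ p
    p≥2 = ℕ.nonTrivial⇒n>1 p {{prime⇒nonTrivial p-prime}}
    N = + (p ^ suc k ∸ 1)
    digits = signedDigits r J
    difference = ΣFin-difference≡horner p k r J
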